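{- Let $q$ be a prime power, let $n$ and $m\ge3$ be positive integers, and let $I,J$ be nonnegative integers with $I<J<n$; put $K:=J-I$. Let $\alpha_1,\dots,\alpha_m\in\mathbb{F}_{q^n}^*$ and for $i\in\{1,\dots,m\}$ let $\Pi_i:=\prod_{j=0}^{m-1}\alpha_{i-j}^{q^{(m-1-j)K}}=\alpha_i^{q^{(m-1)K}}\alpha_{i-1}^{q^{(m-2)K}}\cdots\alpha_{i+2}^{q^K}\alpha_{i+1}$, with indices modulo $m$ in $\{1,\dots,m\}$. If $\Pi_{\delta+2}/\Pi_2$ is not a $(q^{mK}-1)$-power in $\mathbb{F}_{q^n}$ for any $\delta=1,\dots,m-1$, then $m$ divides $n$.
   Context: An element $a$ of a field $F$ is a $d$-power in $F$ if $a=y^d$ for some $y\in F$. -}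

module Defs where

open import Level using (Level; _⊔_; suc)
open import Algebra.Bundles using (CommutativeRing)
open import Data.Nat as ℕ using (ℕ; zero; NonZero; _∸_; _≤_)
open import Data.Nat.DivMod using (_mod_)
open import Data.Nat.Primality using (Prime)
open import Data.Fin using (Fin)
open import Data.Product using (∃; _×_; Σ)
open import Relation.Nullary using (¬_)
open import Relation.Binary.PropositionalEquality using (_≡_)

-- A field: commutative ring, 0 ≠ 1, and an inverse operation
-- (total, with the usual convention; only its values on nonzero elements matter).
record Field (c ℓ : Level) : Set (Level.suc (c ⊔ ℓ)) where
  field
    commutativeRing : CommutativeRing c ℓ
  open CommutativeRing commutativeRing public
  field
    _⁻¹       : Carrier → Carrier
    ⁻¹-cong   : ∀ {x y} → x ≈ y → x ⁻¹ ≈ y ⁻¹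
    ⁻¹-inverse : ∀ x → ¬ (x ≈ 0#) → x * (x ⁻¹) ≈ 1#
    0≉1       : ¬ (0# ≈ 1#)

  infixr 8 _^_
  _^_ : Carrier → ℕ → Carrier
  x ^ zero    = 1#
  x ^ ℕ.suc k = x * (x ^ k)

  infixl 7 _/_
  _/_ : Carrier → Carrier → Carrier
  x / y = x * (y ⁻¹)

  prod : ℕ → (ℕ → Carrier) → Carrier
  prod zero    f = 1#
  prod (ℕ.suc k) f = prod k f * f k

  IsPower : ℕ → Carrier → Set (c ⊔ ℓ)
  IsPower d a = Σ Carrier λ y → a ≈ y ^ d

  HasCard : ℕ → Set (c ⊔ ℓ)
  HasCard N = Σ (Fin N → Carrier) λ e →
    (∀ i j → e i ≈ e j → i ≡ j) × (∀ x → Σ (Fin N) λ i → e i ≈ x)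

open Field public using ()

IsPrimePower : ℕ → Set
IsPrimePower q = ∃ λ p → ∃ λ k → Prime p × 1 ≤ k × q ≡ p ℕ.^ k

module _ {c ℓ : Level} (F : Field c ℓ) where
  open Field F

  cyc : (m : ℕ) .{{_ : NonZero m}} → (Fin m → Carrier) → ℕ → Carrier
  cyc m α k = α ((k ∸ 1) mod m)

  -- Π_i = ∏_{j=0}^{m-1} α_{i-j}^{q^{(m-1-j)K}}, indices mod m in {1..m}
  -- (i - j is represented as i + m - j, congruent mod m and ≥ 1 for i ≥ 1).
  Π : (q K m : ℕ) .{{_ : NonZero m}} → (Fin m → Carrier) → ℕ → Carrier
  Π q K m α i = prod m (λ j → cyc m α ((i ℕ.+ m) ∸ j) ^ (q ℕ.^ ((m ∸ 1 ∸ j) ℕ.* K)))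

{-# OPTIONS --safe #-}
-- Put N = q^(mK) - 1 and write x ∼ y when x / y is an N-th power in F*.  The set of
-- d for which x^((q^K)^d) ∼ x for every x ∈ F* is closed under sums and differences.
-- It contains m, because x^(q^(mK)) = x · x^N, and n, because x^(q^n) = x; by Bézout
-- it therefore contains δ = gcd m n.  Since the indices of the α's are periodic,
-- Π_(i+1)^(q^K) = Π_i · α_(i+1)^N, so Π_(δ+i)^((q^K)^δ) ∼ Π_i and hence
-- Π_(δ+2) ∼ Π_2.  If m does not divide n, then 1 ≤ δ ≤ m - 1, contradicting the
-- hypothesis.
module Submission where

open import Defs
open import Level using (Level)
open import Data.Nat using (ℕ; NonZero; _∸_; _≤_; _<_; _^_; _*_; _+_)
open import Data.Nat.Divisibility using (_∣_)
open import Data.Fin using (Fin)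
open import Relation.Nullary using (¬_)

open import Level using (_⊔_)
open import Data.Nat.Base using (zero; suc; ≢-nonZero⁻¹)
open import Data.Nat.Properties as ℕ
  using (+-suc; n<1+n; m<n⇒m<1+n; ≤∧≢⇒<; <⇒≤pred; n≢0⇒n>0; suc-pred; n∸n≡0;
         m+n∸n≡m; +-∸-assoc; ^-distribˡ-+-*; ^-*-assoc; m^n≢0)
open import Data.Nat.Divisibility using (_∣?_; ∣⇒≤)
open import Data.Nat.DivMod using ([m+n]%n≡m%n)
open import Data.Nat.GCD
  using (gcd; gcd-GCD; module Bézout; gcd[m,n]∣m; gcd[m,n]∣n; gcd[m,n]≢0)
open import Data.Nat.Primality using (prime⇒nonZero)
import Data.Fin.Base as Fin
open import Data.Fin.Properties
  using (fromℕ<-cong; punchIn-injective; punchInᵢ≢i; punchIn-punchOut)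
open import Data.Fin.Permutation using (Permutation; permutation)
open import Data.Product using (Σ-syntax; _,_; proj₁; proj₂; _×_)
open import Data.Sum using (inj₁)
open import Function using (_∘_)
open import Relation.Nullary using (yes; no; contradiction)
open import Relation.Binary.Core using (Rel)
open import Relation.Binary.Bundles using (Preorder)
import Relation.Binary.PropositionalEquality as ≡
open ≡ using (_≡_; _≢_)
import Relation.Binary.Reasoning.Setoid as SetoidReasoning
import Relation.Binary.Reasoning.Preorder as PreorderReasoning
import Algebra.Properties.CommutativeSemigroup as CommutativeSemigroupProperties
import Algebra.Properties.CommutativeSemiring.Exp as CommutativeSemiringExp
import Algebra.Properties.CommutativeMonoid.Sum as CommutativeMonoidSum

module _ {p} (T : ℕ → Set p)
         (+-closed : ∀ a b → T a → T b → T (a + b))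
         (∸-closed : ∀ a b → T a → T (b + a) → T b)
         where

  *-closed : ∀ k a → T a → T (k * a)
  *-closed zero    a Ta = ∸-closed a 0 Ta Ta
  *-closed (suc k) a Ta = +-closed a (k * a) Ta (*-closed k a Ta)

  gcd-closed : ∀ m n → T m → T n → T (gcd m n)
  gcd-closed m n Tm Tn with Bézout.identity (gcd-GCD m n)
  ... | Bézout.+- x y eq =
    ∸-closed (y * n) (gcd m n) (*-closed y n Tn) (≡.subst T (≡.sym eq) (*-closed x m Tm))
  ... | Bézout.-+ x y eq =
    ∸-closed (x * m) (gcd m n) (*-closed x m Tm) (≡.subst T (≡.sym eq) (*-closed y n Tn))

gcd[m,n]>0 : ∀ m {n} .{{_ : NonZero m}} → 0 < gcd m n
gcd[m,n]>0 m {n} = n≢0⇒n>0 (gcd[m,n]≢0 m n (inj₁ (≢-nonZero⁻¹ m)))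

m∤n⇒gcd[m,n]<m : ∀ {m n} .{{_ : NonZero m}} → ¬ m ∣ n → gcd m n < m
m∤n⇒gcd[m,n]<m {m} {n} m∤n =
  ≤∧≢⇒< (∣⇒≤ (gcd[m,n]∣m m n)) (λ g≡m → m∤n (≡.subst (_∣ n) g≡m (gcd[m,n]∣n m n)))

[m^n]^o≡[m^o]^n : ∀ m n o → (m ^ n) ^ o ≡ (m ^ o) ^ n
[m^n]^o≡[m^o]^n m n o =
  ≡.trans (^-*-assoc m n o)
          (≡.trans (≡.cong (m ^_) (ℕ.*-comm n o)) (≡.sym (^-*-assoc m o n)))

m^[n*o]*m^o≡m^[[1+n]*o] : ∀ m n o → m ^ (n * o) * m ^ o ≡ m ^ (suc n * o)
m^[n*o]*m^o≡m^[[1+n]*o] m n o =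
  ≡.trans (≡.sym (^-distribˡ-+-* m (n * o) o)) (≡.cong (m ^_) (ℕ.+-comm (n * o) o))

IsPrimePower⇒NonZero : ∀ {q} → IsPrimePower q → NonZero q
IsPrimePower⇒NonZero (p , k , p-prime , _ , ≡.refl) = m^n≢0 p k {{prime⇒nonZero p-prime}}

module _ {ℓ₁ ℓ₂} (F : Field ℓ₁ ℓ₂) where
  open Field F hiding (_+_) renaming (_*_ to _·_; _^_ to _^ᶠ_)
  open CommutativeSemigroupProperties *-commutativeSemigroup using (xy∙z≈y∙xz; xy∙z≈zx∙y)
  open CommutativeMonoidSum *-commutativeMonoid
    using (sum-permute; sum-cong-≋; ∑-distrib-+; sum-replicate) renaming (sum to ∏)
  private
    module Exp = CommutativeSemiringExp commutativeSemiring
    module ≈-Reasoning = SetoidReasoning setoid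

  ^ᶠ≡^ : ∀ x k → x ^ᶠ k ≡ x Exp.^ k
  ^ᶠ≡^ x zero    = ≡.refl
  ^ᶠ≡^ x (suc k) = ≡.cong (x ·_) (^ᶠ≡^ x k)

  ^-congˡ : ∀ k {x y} → x ≈ y → x ^ᶠ k ≈ y ^ᶠ k
  ^-congˡ k {x} {y} x≈y rewrite ^ᶠ≡^ x k | ^ᶠ≡^ y k = Exp.^-congˡ k x≈y

  ^-congʳ : ∀ x {j k} → j ≡ k → x ^ᶠ j ≈ x ^ᶠ k
  ^-congʳ x ≡.refl = refl

  ^-assocʳ : ∀ x j k → (x ^ᶠ j) ^ᶠ k ≈ x ^ᶠ (j * k)
  ^-assocʳ x j k rewrite ^ᶠ≡^ (x ^ᶠ j) k | ^ᶠ≡^ x j | ^ᶠ≡^ x (j * k) = Exp.^-assocʳ x j k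

  ^-distrib-* : ∀ x y k → (x · y) ^ᶠ k ≈ x ^ᶠ k · y ^ᶠ k
  ^-distrib-* x y k rewrite ^ᶠ≡^ (x · y) k | ^ᶠ≡^ x k | ^ᶠ≡^ y k = Exp.^-distrib-* x y k

  [x^j]^k≈[x^k]^j : ∀ x j k → (x ^ᶠ j) ^ᶠ k ≈ (x ^ᶠ k) ^ᶠ j
  [x^j]^k≈[x^k]^j x j k =
    trans (^-assocʳ x j k) (trans (^-congʳ x (ℕ.*-comm j k)) (sym (^-assocʳ x k j)))

  1^k≈1 : ∀ k → 1# ^ᶠ k ≈ 1#
  1^k≈1 zero    = refl
  1^k≈1 (suc k) = trans (*-identityˡ (1# ^ᶠ k)) (1^k≈1 k)

  x^M≈x⇒x^[M^k]≈x : ∀ {x M} → x ^ᶠ M ≈ x → ∀ k → x ^ᶠ (M ^ k) ≈ x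
  x^M≈x⇒x^[M^k]≈x {x} {M} x^M≈x zero    = *-identityʳ x
  x^M≈x⇒x^[M^k]≈x {x} {M} x^M≈x (suc k) = begin
    x ^ᶠ (M * M ^ k)     ≈⟨ ^-assocʳ x M (M ^ k) ⟨
    (x ^ᶠ M) ^ᶠ (M ^ k)  ≈⟨ ^-congˡ (M ^ k) x^M≈x ⟩
    x ^ᶠ (M ^ k)         ≈⟨ x^M≈x⇒x^[M^k]≈x x^M≈x k ⟩
    x                    ∎
    where open ≈-Reasoning

  1≉0 : 1# ≉ 0#
  1≉0 1≈0 = 0≉1 (sym 1≈0)

  ⁻¹-inverseˡ : ∀ {x} → x ≉ 0# → x ⁻¹ · x ≈ 1#
  ⁻¹-inverseˡ {x} x≉0 = trans (*-comm (x ⁻¹) x) (⁻¹-inverse x x≉0)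

  *-cancelʳ : ∀ {x y z} → z ≉ 0# → x · z ≈ y · z → x ≈ y
  *-cancelʳ {x} {y} {z} z≉0 xz≈yz = begin
    x               ≈⟨ *-identityʳ x ⟨
    x · 1#          ≈⟨ *-congˡ (⁻¹-inverse z z≉0) ⟨
    x · (z · z ⁻¹)  ≈⟨ *-assoc x z (z ⁻¹) ⟨
    x · z · z ⁻¹    ≈⟨ *-congʳ xz≈yz ⟩
    y · z · z ⁻¹    ≈⟨ *-assoc y z (z ⁻¹) ⟩
    y · (z · z ⁻¹)  ≈⟨ *-congˡ (⁻¹-inverse z z≉0) ⟩
    y · 1#          ≈⟨ *-identityʳ y ⟩
    y               ∎
    where open ≈-Reasoning

  *-≉0 : ∀ {x y} → x ≉ 0# → y ≉ 0# → x · y ≉ 0#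
  *-≉0 {x} {y} x≉0 y≉0 xy≈0 = x≉0 (*-cancelʳ y≉0 (trans xy≈0 (sym (zeroˡ y))))

  ^-≉0 : ∀ {x} → x ≉ 0# → ∀ k → x ^ᶠ k ≉ 0#
  ^-≉0 x≉0 zero    = 1≉0
  ^-≉0 x≉0 (suc k) = *-≉0 x≉0 (^-≉0 x≉0 k)

  ⁻¹-≉0 : ∀ {x} → x ≉ 0# → x ⁻¹ ≉ 0#
  ⁻¹-≉0 {x} x≉0 x⁻¹≈0 = 0≉1 (begin
    0#          ≈⟨ zeroʳ x ⟨
    x · 0#      ≈⟨ *-congˡ x⁻¹≈0 ⟨
    x · x ⁻¹    ≈⟨ ⁻¹-inverse x x≉0 ⟩
    1#          ∎)
    where open ≈-Reasoning

  prod-cong : ∀ k {f g : ℕ → Carrier} → (∀ j → j < k → f j ≈ g j) → prod k f ≈ prod k g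
  prod-cong zero    f≈g = refl
  prod-cong (suc k) f≈g =
    *-cong (prod-cong k (λ j j<k → f≈g j (m<n⇒m<1+n j<k))) (f≈g k (n<1+n k))

  ^-distrib-prod : ∀ k f e → prod k f ^ᶠ e ≈ prod k (λ j → f j ^ᶠ e)
  ^-distrib-prod zero    f e = 1^k≈1 e
  ^-distrib-prod (suc k) f e =
    trans (^-distrib-* (prod k f) (f k) e) (*-congʳ (^-distrib-prod k f e))

  prod-suc : ∀ k f → prod (suc k) f ≈ f 0 · prod k (f ∘ suc)
  prod-suc zero    f = trans (*-identityˡ (f 0)) (sym (*-identityʳ (f 0)))
  prod-suc (suc k) f =
    trans (*-congʳ (prod-suc k f)) (*-assoc (f 0) (prod k (f ∘ suc)) (f (suc k)))

  prod-≉0 : ∀ k {f} → (∀ j → f j ≉ 0#) → prod k f ≉ 0#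
  prod-≉0 zero    f≉0 = 1≉0
  prod-≉0 (suc k) f≉0 = *-≉0 (prod-≉0 k f≉0) (f≉0 k)

  ∏-≉0 : ∀ {k} (f : Fin k → Carrier) → (∀ i → f i ≉ 0#) → ∏ f ≉ 0#
  ∏-≉0 {zero}  f f≉0 = 1≉0
  ∏-≉0 {suc k} f f≉0 = *-≉0 (f≉0 Fin.zero) (∏-≉0 (f ∘ Fin.suc) (f≉0 ∘ Fin.suc))

  ∏-const : ∀ k x → ∏ {k} (λ _ → x) ≈ x ^ᶠ k
  ∏-const k x = trans (sum-replicate k) (reflexive (≡.sym (^ᶠ≡^ x k)))

  record NonzeroEnumeration (n : ℕ) : Set (ℓ₁ ⊔ ℓ₂) where
    field
      elem           : Fin n → Carrier
      elem-≉0        : ∀ i → elem i ≉ 0#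
      elem-injective : ∀ {i j} → elem i ≈ elem j → i ≡ j
      index          : ∀ y → y ≉ 0# → Fin n
      elem-index     : ∀ y (y≉0 : y ≉ 0#) → elem (index y y≉0) ≈ y

  nonzeroEnumeration : ∀ {n} → HasCard (suc n) → NonzeroEnumeration n
  nonzeroEnumeration {n} (e , e-injective , e-surjective) = record
    { elem           = e ∘ Fin.punchIn i₀
    ; elem-≉0        = λ i e≈0 →
        punchInᵢ≢i i₀ i (e-injective _ _ (trans e≈0 (sym e[i₀]≈0)))
    ; elem-injective = λ {i} {j} eq → punchIn-injective i₀ i j (e-injective _ _ eq)
    ; index          = λ y y≉0 → Fin.punchOut (i₀≢ y y≉0)
    ; elem-index     = λ y y≉0 →
        trans (reflexive (≡.cong e (punchIn-punchOut (i₀≢ y y≉0)))) (proj₂ (e-surjective y))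
    }
    where
    i₀ : Fin (suc n)
    i₀ = proj₁ (e-surjective 0#)

    e[i₀]≈0 : e i₀ ≈ 0#
    e[i₀]≈0 = proj₂ (e-surjective 0#)

    i₀≢ : ∀ y → y ≉ 0# → i₀ ≢ proj₁ (e-surjective y)
    i₀≢ y y≉0 i₀≡i = y≉0 (begin
      y                          ≈⟨ proj₂ (e-surjective y) ⟨
      e (proj₁ (e-surjective y)) ≡⟨ ≡.cong e i₀≡i ⟨
      e i₀                       ≈⟨ e[i₀]≈0 ⟩
      0#                         ∎)
      where open ≈-Reasoning

  module _ {n} (F* : NonzeroEnumeration n) where
    open NonzeroEnumeration F*

    scale : ∀ {a} → a ≉ 0# → Fin n → Fin n
    scale {a} a≉0 i = index (a · elem i) (*-≉0 a≉0 (elem-≉0 i))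

    scale-inverse : ∀ {a b} (a≉0 : a ≉ 0#) (b≉0 : b ≉ 0#) → a · b ≈ 1# →
                    ∀ i → scale a≉0 (scale b≉0 i) ≡ i
    scale-inverse {a} {b} a≉0 b≉0 ab≈1 i = elem-injective (begin
      elem (scale a≉0 (scale b≉0 i))  ≈⟨ elem-index _ _ ⟩
      a · elem (scale b≉0 i)          ≈⟨ *-congˡ (elem-index _ _) ⟩
      a · (b · elem i)                ≈⟨ *-assoc a b (elem i) ⟨
      a · b · elem i                  ≈⟨ *-congʳ ab≈1 ⟩
      1# · elem i                     ≈⟨ *-identityˡ (elem i) ⟩
      elem i                          ∎)
      where open ≈-Reasoning

    scalePermutation : ∀ {x} → x ≉ 0# → Permutation n n
    scalePermutation {x} x≉0 = permutation (scale x≉0) (scale (⁻¹-≉0 x≉0))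
      (scale-inverse x≉0 (⁻¹-≉0 x≉0) (⁻¹-inverse x x≉0))
      (scale-inverse (⁻¹-≉0 x≉0) x≉0 (⁻¹-inverseˡ x≉0))

    x^n≈1 : ∀ {x} → x ≉ 0# → x ^ᶠ n ≈ 1#
    x^n≈1 {x} x≉0 = *-cancelʳ (∏-≉0 elem elem-≉0) (begin
      x ^ᶠ n · ∏ elem                 ≈⟨ *-congʳ (∏-const n x) ⟨
      ∏ (λ (_ : Fin n) → x) · ∏ elem  ≈⟨ ∑-distrib-+ (λ _ → x) elem ⟨
      ∏ (λ i → x · elem i)            ≈⟨ sum-cong-≋ (λ i → elem-index (x · elem i) _) ⟨
      ∏ (elem ∘ scale x≉0)            ≈⟨ sum-permute elem (scalePermutation x≉0) ⟨
      ∏ elem                          ≈⟨ *-identityˡ (∏ elem) ⟨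
      1# · ∏ elem                     ∎)
      where open ≈-Reasoning

  x^card≈x : ∀ {M} → HasCard M → ∀ {x} → x ≉ 0# → x ^ᶠ M ≈ x
  x^card≈x {zero}  (_ , _ , e-surjective) {x} _ = contradiction (proj₁ (e-surjective x)) λ ()
  x^card≈x {suc n} card {x} x≉0 =
    trans (*-congˡ (x^n≈1 (nonzeroEnumeration card) x≉0)) (*-identityʳ x)

  cyc-periodic : ∀ m .{{_ : NonZero m}} (α : Fin m → Carrier) i →
                 cyc F m α (suc i + m) ≡ cyc F m α (suc i)
  cyc-periodic m α i = ≡.cong α (fromℕ<-cong _ _ ([m+n]%n≡m%n i m) _ _)

  Π-≉0 : ∀ q K m .{{_ : NonZero m}} {α : Fin m → Carrier} → (∀ j → α j ≉ 0#) →
         ∀ i → Π F q K m α i ≉ 0#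
  Π-≉0 q K m α≉0 i = prod-≉0 m (λ j → ^-≉0 (α≉0 _) (q ^ ((m ∸ 1 ∸ j) * K)))

  module ModPowers (N : ℕ) where
    -- With w ≉ 0#, x ∼ y says that x and y lie in the same coset of (F*)^N.
    infix 4 _∼_
    _∼_ : Rel Carrier (ℓ₁ ⊔ ℓ₂)
    x ∼ y = Σ[ w ∈ Carrier ] w ≉ 0# × x ≈ y · w ^ᶠ N

    ∼-reflexive : ∀ {x y} → x ≈ y → x ∼ y
    ∼-reflexive {x} {y} x≈y = 1# , 1≉0 , (begin
      x            ≈⟨ x≈y ⟩
      y            ≈⟨ *-identityʳ y ⟨
      y · 1#       ≈⟨ *-congˡ (1^k≈1 N) ⟨
      y · 1# ^ᶠ N  ∎)
      where open ≈-Reasoning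

    ∼-sym : ∀ {x y} → x ∼ y → y ∼ x
    ∼-sym {x} {y} (w , w≉0 , x≈yw) = w ⁻¹ , ⁻¹-≉0 w≉0 , (begin
      y                            ≈⟨ *-identityʳ y ⟨
      y · 1#                       ≈⟨ *-congˡ (1^k≈1 N) ⟨
      y · 1# ^ᶠ N                  ≈⟨ *-congˡ (^-congˡ N (⁻¹-inverse w w≉0)) ⟨
      y · (w · w ⁻¹) ^ᶠ N          ≈⟨ *-congˡ (^-distrib-* w (w ⁻¹) N) ⟩
      y · (w ^ᶠ N · w ⁻¹ ^ᶠ N)     ≈⟨ *-assoc y _ _ ⟨
      y · w ^ᶠ N · w ⁻¹ ^ᶠ N       ≈⟨ *-congʳ x≈yw ⟨
      x · w ⁻¹ ^ᶠ N                ∎)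
      where open ≈-Reasoning

    ∼-trans : ∀ {x y z} → x ∼ y → y ∼ z → x ∼ z
    ∼-trans {x} {y} {z} (w , w≉0 , x≈yw) (v , v≉0 , y≈zv) = v · w , *-≉0 v≉0 w≉0 , (begin
      x                        ≈⟨ x≈yw ⟩
      y · w ^ᶠ N               ≈⟨ *-congʳ y≈zv ⟩
      z · v ^ᶠ N · w ^ᶠ N      ≈⟨ *-assoc z _ _ ⟩
      z · (v ^ᶠ N · w ^ᶠ N)    ≈⟨ *-congˡ (^-distrib-* v w N) ⟨
      z · (v · w) ^ᶠ N         ∎)
      where open ≈-Reasoning

    ∼-^ : ∀ k {x y} → x ∼ y → x ^ᶠ k ∼ y ^ᶠ k
    ∼-^ k {x} {y} (w , w≉0 , x≈yw) = w ^ᶠ k , ^-≉0 w≉0 k , (begin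
      x ^ᶠ k                   ≈⟨ ^-congˡ k x≈yw ⟩
      (y · w ^ᶠ N) ^ᶠ k        ≈⟨ ^-distrib-* y (w ^ᶠ N) k ⟩
      y ^ᶠ k · (w ^ᶠ N) ^ᶠ k   ≈⟨ *-congˡ ([x^j]^k≈[x^k]^j w N k) ⟩
      y ^ᶠ k · (w ^ᶠ k) ^ᶠ N   ∎)
      where open ≈-Reasoning

    ∼⇒IsPower : ∀ {x y} → x ∼ y → y ≉ 0# → IsPower N (x / y)
    ∼⇒IsPower {x} {y} (w , _ , x≈yw) y≉0 = w , (begin
      x · y ⁻¹                 ≈⟨ *-congʳ x≈yw ⟩
      y · w ^ᶠ N · y ⁻¹        ≈⟨ xy∙z≈y∙xz y (w ^ᶠ N) (y ⁻¹) ⟩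
      w ^ᶠ N · (y · y ⁻¹)      ≈⟨ *-congˡ (⁻¹-inverse y y≉0) ⟩
      w ^ᶠ N · 1#              ≈⟨ *-identityʳ (w ^ᶠ N) ⟩
      w ^ᶠ N                   ∎)
      where open ≈-Reasoning

    ∼-preorder : Preorder ℓ₁ ℓ₂ (ℓ₁ ⊔ ℓ₂)
    ∼-preorder = record
      { isPreorder = record
        { isEquivalence = isEquivalence
        ; reflexive     = ∼-reflexive
        ; trans         = ∼-trans
        }
      }

    module ∼-Reasoning = PreorderReasoning ∼-preorder

    TrivialIterate : ℕ → ℕ → Set (ℓ₁ ⊔ ℓ₂)
    TrivialIterate Q d = ∀ {x} → x ≉ 0# → x ^ᶠ (Q ^ d) ∼ x

    TrivialIterate-+ : ∀ Q a b →
                       TrivialIterate Q a → TrivialIterate Q b → TrivialIterate Q (a + b)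
    TrivialIterate-+ Q a b Ta Tb {x} x≉0 = begin
      x ^ᶠ (Q ^ (a + b))         ≡⟨ ≡.cong (x ^ᶠ_) (^-distribˡ-+-* Q a b) ⟩
      x ^ᶠ (Q ^ a * Q ^ b)       ≈⟨ ^-assocʳ x (Q ^ a) (Q ^ b) ⟨
      (x ^ᶠ (Q ^ a)) ^ᶠ (Q ^ b)  ≲⟨ ∼-^ (Q ^ b) (Ta x≉0) ⟩
      x ^ᶠ (Q ^ b)               ≲⟨ Tb x≉0 ⟩
      x                          ∎
      where open ∼-Reasoning

    TrivialIterate-∸ : ∀ Q a b →
                       TrivialIterate Q a → TrivialIterate Q (b + a) → TrivialIterate Q b
    TrivialIterate-∸ Q a b Ta Tba {x} x≉0 = begin
      x ^ᶠ (Q ^ b)               ≲⟨ ∼-sym (Ta (^-≉0 x≉0 (Q ^ b))) ⟩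
      (x ^ᶠ (Q ^ b)) ^ᶠ (Q ^ a)  ≈⟨ ^-assocʳ x (Q ^ b) (Q ^ a) ⟩
      x ^ᶠ (Q ^ b * Q ^ a)       ≡⟨ ≡.cong (x ^ᶠ_) (^-distribˡ-+-* Q b a) ⟨
      x ^ᶠ (Q ^ (b + a))         ≲⟨ Tba x≉0 ⟩
      x                          ∎
      where open ∼-Reasoning

    TrivialIterate-period : ∀ q K m → q ^ (m * K) ≡ suc N → TrivialIterate (q ^ K) m
    TrivialIterate-period q K m q^mK≡1+N {x} x≉0 =
      x , x≉0 , ^-congʳ x (≡.trans (^-*-assoc q K m)
                                   (≡.trans (≡.cong (q ^_) (ℕ.*-comm K m)) q^mK≡1+N))

    TrivialIterate-card : ∀ q n K → HasCard (q ^ n) → TrivialIterate (q ^ K) n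
    TrivialIterate-card q n K card {x} x≉0 = ∼-reflexive (begin
      x ^ᶠ ((q ^ K) ^ n)  ≡⟨ ≡.cong (x ^ᶠ_) ([m^n]^o≡[m^o]^n q K n) ⟩
      x ^ᶠ ((q ^ n) ^ K)  ≈⟨ x^M≈x⇒x^[M^k]≈x (x^card≈x card x≉0) K ⟩
      x                   ∎)
      where open ≈-Reasoning

    module _ {Q} {P : ℕ → Carrier} (P-step : ∀ i → P (suc i) ^ᶠ Q ∼ P i) where

      P-steps : ∀ s i → P (s + i) ^ᶠ (Q ^ s) ∼ P i
      P-steps zero    i = ∼-reflexive (*-identityʳ (P i))
      P-steps (suc s) i = begin
        P (suc s + i) ^ᶠ (Q * Q ^ s)       ≈⟨ ^-assocʳ (P (suc s + i)) Q (Q ^ s) ⟨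
        (P (suc s + i) ^ᶠ Q) ^ᶠ (Q ^ s)    ≲⟨ ∼-^ (Q ^ s) (P-step (s + i)) ⟩
        P (s + i) ^ᶠ (Q ^ s)               ≲⟨ P-steps s i ⟩
        P i                                ∎
        where open ∼-Reasoning

      TrivialIterate⇒P-shift : ∀ {d} → TrivialIterate Q d →
                               ∀ i → P (d + i) ≉ 0# → P (d + i) ∼ P i
      TrivialIterate⇒P-shift {d} Td i P≉0 = ∼-trans (∼-sym (Td P≉0)) (P-steps d i)

    -- Raising to q^K shifts the exponents of the factors of Π_(i+1) by one, so that they
    -- become those of Π_i, except that the first factor becomes α_(i+1)^(q^(mK)) =
    -- α_(i+1)^(N+1), while the last factor of Π_i is α_(i+1) itself.
    Π-step : ∀ q K m .{{_ : NonZero m}} {α : Fin m → Carrier} → (∀ j → α j ≉ 0#) →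
             q ^ (m * K) ≡ suc N → ∀ i → Π F q K m α (suc i) ^ᶠ (q ^ K) ∼ Π F q K m α i
    Π-step q K m@(suc p) {α} α≉0 q^mK≡1+N i = c (suc i) , α≉0 _ , (begin
      prod m g ^ᶠ Q                             ≈⟨ ^-distrib-prod m g Q ⟩
      prod m (λ j → g j ^ᶠ Q)                   ≈⟨ prod-suc p (λ j → g j ^ᶠ Q) ⟩
      g 0 ^ᶠ Q · prod p (λ j → g (suc j) ^ᶠ Q)  ≈⟨ *-cong first rest ⟩
      c (suc i) · c (suc i) ^ᶠ N · prod p f     ≈⟨ xy∙z≈zx∙y (c (suc i)) _ (prod p f) ⟩
      prod p f · c (suc i) · c (suc i) ^ᶠ N     ≈⟨ *-congʳ (*-congˡ last) ⟨
      prod p f · f p · c (suc i) ^ᶠ N           ∎)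
      where
      open ≈-Reasoning
      Q : ℕ
      Q = q ^ K
      c g f : ℕ → Carrier
      c = cyc F m α
      g j = c (suc i + m ∸ j) ^ᶠ (q ^ ((p ∸ j) * K))
      f j = c (i + m ∸ j) ^ᶠ (q ^ ((p ∸ j) * K))

      raise : ∀ x a → (x ^ᶠ (q ^ (a * K))) ^ᶠ Q ≈ x ^ᶠ (q ^ (suc a * K))
      raise x a =
        trans (^-assocʳ x (q ^ (a * K)) Q) (^-congʳ x (m^[n*o]*m^o≡m^[[1+n]*o] q a K))

      first : g 0 ^ᶠ Q ≈ c (suc i) ^ᶠ suc N
      first = begin
        g 0 ^ᶠ Q                        ≈⟨ raise (c (suc i + m)) p ⟩
        c (suc i + m) ^ᶠ (q ^ (m * K))  ≡⟨ ≡.cong₂ _^ᶠ_ (cyc-periodic m α i) q^mK≡1+N ⟩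
        c (suc i) ^ᶠ suc N              ∎

      rest : prod p (λ j → g (suc j) ^ᶠ Q) ≈ prod p f
      rest = prod-cong p λ j j<p →
        trans (raise (c (i + m ∸ j)) (p ∸ suc j))
              (^-congʳ (c (i + m ∸ j)) (≡.cong ((q ^_) ∘ (_* K)) (≡.sym (+-∸-assoc 1 j<p))))

      i+m∸p≡1+i : i + m ∸ p ≡ suc i
      i+m∸p≡1+i = ≡.trans (≡.cong (_∸ p) (+-suc i p)) (m+n∸n≡m (suc i) p)

      last : f p ≈ c (suc i)
      last = begin
        c (i + m ∸ p) ^ᶠ (q ^ ((p ∸ p) * K))  ≈⟨ ^-congʳ _ (≡.cong ((q ^_) ∘ (_* K)) (n∸n≡0 p)) ⟩
        c (i + m ∸ p) ^ᶠ 1                    ≈⟨ *-identityʳ (c (i + m ∸ p)) ⟩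
        c (i + m ∸ p)                         ≡⟨ ≡.cong c i+m∸p≡1+i ⟩
        c (suc i)                             ∎

mainTheorem8 : {c ℓ : Level} (q n m I J : ℕ) .{{_ : NonZero m}} →
    IsPrimePower q → 1 ≤ n → 3 ≤ m → I < J → J < n →
    (F : Field c ℓ) → Field.HasCard F (q ^ n) →
    (α : Fin m → Field.Carrier F) → (∀ i → ¬ Field._≈_ F (α i) (Field.0# F)) →
    (∀ δ → 1 ≤ δ → δ ≤ m ∸ 1 →
      ¬ Field.IsPower F (q ^ (m * (J ∸ I)) ∸ 1)
          (Field._/_ F (Π F q (J ∸ I) m α (δ + 2)) (Π F q (J ∸ I) m α 2))) →
    m ∣ n
mainTheorem8 q n m I J q-primePower _ _ _ _ F card α α≉0 ¬isPower with m ∣? n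
... | yes m∣n = m∣n
... | no  m∤n = contradiction Π[δ+2]/Π[2]-isPower
                  (¬isPower δ (gcd[m,n]>0 m) (<⇒≤pred (m∤n⇒gcd[m,n]<m m∤n)))
  where
  open Field F using (IsPower; _/_)
  K Q N δ : ℕ
  K = J ∸ I
  Q = q ^ K
  N = q ^ (m * K) ∸ 1
  δ = gcd m n
  open ModPowers F N

  q^mK≡1+N : q ^ (m * K) ≡ suc N
  q^mK≡1+N =
    ≡.sym (suc-pred (q ^ (m * K)) {{m^n≢0 q (m * K) {{IsPrimePower⇒NonZero q-primePower}}}})

  δ-trivial : TrivialIterate Q δ
  δ-trivial = gcd-closed (TrivialIterate Q) (TrivialIterate-+ Q) (TrivialIterate-∸ Q) m n
                (TrivialIterate-period q K m q^mK≡1+N) (TrivialIterate-card q n K card)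

  Π[δ+2]/Π[2]-isPower : IsPower N (Π F q K m α (δ + 2) / Π F q K m α 2)
  Π[δ+2]/Π[2]-isPower = ∼⇒IsPower
    (TrivialIterate⇒P-shift (Π-step q K m α≉0 q^mK≡1+N) δ-trivial 2
      (Π-≉0 F q K m α≉0 (δ + 2)))
    (Π-≉0 F q K m α≉0 2)
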